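{- Let $n\ge 2$ targets $\mathcal T=\{1,\dots,n\}$ be given with travel times $c(u,v)>0$ ($u\ne v$) satisfying the triangle inequality, let $k\ge n$, and let $\mathcal W^*=(v_1,\dots,v_{k+1})$ be a closed walk with $k$ visits satisfying $\mathcal R(\mathcal W^*)=\mathcal R^*(k)$. Let $(v_i)_{i\ge1}$ be its periodic extension, and let $i<j$ be indices and $d$ a target with $v_i=v_j=d$, $v_l\ne d$ for $i<l<j$, and $\sum_{l=i}^{j-1}c(v_l,v_{l+1})=\mathcal R^*(k)$ (i.e. $(v_i,\dots,v_j)$ is a binding subwalk). Then every target of $\mathcal T$ appears among $v_i,\dots,v_j$.
   Context: Targets $\mathcal T=\{1,\dots,n\}$, $n\ge 2$; travel times $c(u,v)>0$ for distinct $u,v\in\mathcal T$ (set $c(u,u)=0$), satisfying $c(u,v)+c(v,w)\ge c(u,w)$ for all $u,v,w\in\mathcal T$. For an integer $k\ge n$, a closed walk with $k$ visits is a sequence $\mathcal W=(v_1,\dots,v_{k+1})$ of targets with $v_{k+1}=v_1$, $v_i\ne v_{i+1}$ for $1\le i\le k$, and every target appearing among $v_1,\dots,v_k$. The walk is repeated forever: extend it to the infinite periodic sequence $(v_i)_{i\ge 1}$ with $v_{i+k}=v_i$, where moving from $v_i$ to $v_{i+1}$ takes time $c(v_i,v_{i+1})$. For a target $d$, the revisit time $RT(d,\mathcal W)$ is the maximum, over all pairs of indices $i<j$ with $v_i=v_j=d$ and $v_l\ne d$ for $i<l<j$, of $\sum_{l=i}^{j-1}c(v_l,v_{l+1})$.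 The revisit time of the walk is $\mathcal R(\mathcal W)=\max_{d\in\mathcal T}RT(d,\mathcal W)$, and $\mathcal R^*(k)$ is the minimum of $\mathcal R(\mathcal W)$ over all closed walks with $k$ visits.
   Formalization: The travel times $c(u,v)$ take rational values, so the walk costs and $\mathcal R^*(k)$ are rational as well. -}

module Defs where

open import Data.Nat using (ℕ; zero; suc; _<_; _≤_) renaming (_+_ to _+ℕ_)
open import Data.Fin using (Fin)
open import Data.Rational using (ℚ; 0ℚ; _+_) renaming (_<_ to _<ℚ_; _≤_ to _≤ℚ_)
open import Data.Product using (Σ; _×_; ∃)
open import Relation.Binary.PropositionalEquality using (_≡_; _≢_)

-- Travel-time data on the targets Fin n (target u of the paper is Fin n, 0-indexed):
-- c(u,v) > 0 for u ≠ v, c(u,u) = 0, triangle inequality.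
record TravelTimes (n : ℕ) : Set where
  field
    c        : Fin n → Fin n → ℚ
    pos      : ∀ u v → u ≢ v → 0ℚ <ℚ c u v
    diag     : ∀ u → c u u ≡ 0ℚ
    triangle : ∀ u v w → c u w ≤ℚ (c u v + c v w)

-- A closed walk with k visits (v_1,…,v_{k+1}), v_{k+1} = v_1, given through its
-- infinite periodic extension (indices shifted to start at 0):
-- seq 0, …, seq k is the walk, and seq (i + k) = seq i.
record ClosedWalk (n k : ℕ) : Set where
  field
    seq      : ℕ → Fin n
    periodic : ∀ i → seq (i +ℕ k) ≡ seq i
    noStay   : ∀ i → i < k → seq i ≢ seq (suc i)
    covers   : ∀ (t : Fin n) → ∃ λ i → i < k × seq i ≡ t
open ClosedWalk public

pathCost : ∀ {n} → (Fin n → Fin n → ℚ) → (ℕ → Fin n) → ℕ → ℕ → ℚ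
pathCost c v i zero    = 0ℚ
pathCost c v i (suc m) = c (v i) (v (suc i)) + pathCost c v (suc i) m

ConsecutiveVisits : ∀ {n} → (ℕ → Fin n) → Fin n → ℕ → ℕ → Set
ConsecutiveVisits v d i m =
  1 ≤ m × v i ≡ d × v (i +ℕ m) ≡ d × (∀ l → 0 < l → l < m → v (i +ℕ l) ≢ d)

-- r = R(W) = max over targets d of RT(d,W), i.e. r is the maximum of the
-- costs of all consecutive-visit pairs: an upper bound that is attained.
IsRevisitTime : ∀ {n k} → TravelTimes n → ClosedWalk n k → ℚ → Set
IsRevisitTime T W r =
  (∀ d i m → ConsecutiveVisits (seq W) d i m → pathCost (TravelTimes.c T) (seq W) i m ≤ℚ r)
  × (∃ λ d → ∃ λ i → ∃ λ m → ConsecutiveVisits (seq W) d i m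
                              × pathCost (TravelTimes.c T) (seq W) i m ≡ r)

IsOptimalRevisitTime : ∀ {n} → TravelTimes n → ℕ → ℚ → Set
IsOptimalRevisitTime {n} T k r =
  (∃ λ (W : ClosedWalk n k) → IsRevisitTime T W r)
  × (∀ (W : ClosedWalk n k) r′ → IsRevisitTime T W r′ → r ≤ℚ r′)

module Submission where

-- Let (v_i, …, v_{i+m}) be a binding subwalk: consecutive visits of d whose
-- cost equals the revisit time R of the walk, and suppose a target t is absent
-- from it.  Move to the copy of the subwalk one period later, starting at
-- i' = i + k; it still misses t and still costs R.  Since t is visited in
-- every period, there is a last visit p of t before i' and a first visit q of
-- t after i' + m, and (p, q) are consecutive visits of t.  Their cost is at
-- least c(t, d) (triangle inequality on v_p … v_{i'}) plus R (the subwalk)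
-- plus a nonnegative remainder, hence exceeds R — contradicting that R bounds
-- the cost of every pair of consecutive visits.

open import Defs
open import Data.Nat using (ℕ; _≤_; _+_)
open import Data.Fin using (Fin)
open import Data.Rational using (ℚ)
open import Data.Product using (_×_; ∃; _,_)
open import Relation.Binary.PropositionalEquality using (_≡_)

open import Data.Nat using (zero; suc; _<_; _∸_; _*_; z≤n; s≤s; s≤s⁻¹)
open import Data.Nat.Properties
open import Data.Empty using (⊥; ⊥-elim)
open import Relation.Nullary using (yes; no)
open import Relation.Binary.PropositionalEquality
  using (_≢_; refl; sym; trans; cong; cong₂; subst; module ≡-Reasoning)
import Data.Fin as F
import Data.Rational as Q
import Data.Rational.Properties as QP

module WalkCost {n : ℕ} (c : Fin n → Fin n → ℚ) where

  pathCost-split : ∀ v a x y →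
    pathCost c v a (x + y) ≡ pathCost c v a x Q.+ pathCost c v (a + x) y
  pathCost-split v a zero y rewrite +-identityʳ a = sym (QP.+-identityˡ _)
  pathCost-split v a (suc x) y rewrite pathCost-split v (suc a) x y | +-suc a x =
    sym (QP.+-assoc (c (v a) (v (suc a))) (pathCost c v (suc a) x) _)

  pathCost-periodic : ∀ v k → (∀ j → v (j + k) ≡ v j) →
    ∀ a x → pathCost c v (a + k) x ≡ pathCost c v a x
  pathCost-periodic v k per a zero = refl
  pathCost-periodic v k per a (suc x)
    rewrite per a | per (suc a) | pathCost-periodic v k per (suc a) x = refl

module TravelCost {n : ℕ} (T : TravelTimes n) where
  open TravelTimes T
  open WalkCost c

  c-nonneg : ∀ u w → Q.0ℚ Q.≤ c u w
  c-nonneg u w with u F.≟ w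
  ... | yes refl = QP.≤-reflexive (sym (diag u))
  ... | no u≢w   = QP.<⇒≤ (pos u w u≢w)

  direct≤pathCost : ∀ v a x → c (v a) (v (a + x)) Q.≤ pathCost c v a x
  direct≤pathCost v a zero rewrite +-identityʳ a = QP.≤-reflexive (diag (v a))
  direct≤pathCost v a (suc x) rewrite +-suc a x =
    QP.≤-trans (triangle (v a) (v (suc a)) (v (suc (a + x))))
               (QP.+-monoʳ-≤ (c (v a) (v (suc a))) (direct≤pathCost v (suc a) x))

  pathCost-nonneg : ∀ v a x → Q.0ℚ Q.≤ pathCost c v a x
  pathCost-nonneg v a x = QP.≤-trans (c-nonneg _ _) (direct≤pathCost v a x)

  enclosing-pathCost : ∀ v p A m B →
    c (v p) (v (p + A)) Q.+ pathCost c v (p + A) m Q.≤ pathCost c v p (A + (m + B))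
  enclosing-pathCost v p A m B = begin
    c (v p) (v (p + A)) Q.+ pathCost c v (p + A) m
      ≤⟨ QP.+-mono-≤ (direct≤pathCost v p A) middle≤ ⟩
    pathCost c v p A Q.+ (pathCost c v (p + A) m Q.+ pathCost c v (p + A + m) B)
      ≡⟨ cong (pathCost c v p A Q.+_) (sym (pathCost-split v (p + A) m B)) ⟩
    pathCost c v p A Q.+ pathCost c v (p + A) (m + B)
      ≡⟨ sym (pathCost-split v p A (m + B)) ⟩
    pathCost c v p (A + (m + B)) ∎
    where
    open QP.≤-Reasoning
    middle≤ : pathCost c v (p + A) m Q.≤ pathCost c v (p + A) m Q.+ pathCost c v (p + A + m) B
    middle≤ = subst (Q._≤ pathCost c v (p + A) m Q.+ pathCost c v (p + A + m) B)
                (QP.+-identityʳ (pathCost c v (p + A) m))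
                (QP.+-monoʳ-≤ (pathCost c v (p + A) m) (pathCost-nonneg v (p + A + m) B))

module Visits {n : ℕ} (v : ℕ → Fin n) (t : Fin n) where

  AvoidsBetween : ℕ → ℕ → Set
  AvoidsBetween p q = ∀ y → p < y → y < q → v y ≢ t

  lastVisitUpTo : ∀ {s} x → v s ≡ t → s ≤ x →
    ∃ λ p → p ≤ x × v p ≡ t × AvoidsBetween p (suc x)
  lastVisitUpTo zero vs z≤n = 0 , z≤n , vs , λ y 0<y y<1 → ⊥-elim (<-irrefl refl (<-≤-trans 0<y (s≤s⁻¹ y<1)))
  lastVisitUpTo {s} (suc x) vs s≤x+1 with v (suc x) F.≟ t
  ... | yes hit = suc x , ≤-refl , hit , λ y p<y y<p+1 → ⊥-elim (<-irrefl refl (<-≤-trans p<y (s≤s⁻¹ y<p+1)))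
  ... | no miss with lastVisitUpTo x vs (s≤x)
    where
    s≤x : s ≤ x
    s≤x = s≤s⁻¹ (≤∧≢⇒< s≤x+1 (λ { refl → miss vs }))
  ... | p , p≤x , vp , avoid = p , m≤n⇒m≤1+n p≤x , vp , avoid′
    where
    avoid′ : AvoidsBetween p (suc (suc x))
    avoid′ y p<y y<x+2 with y ≟ suc x
    ... | yes refl = miss
    ... | no y≢x+1 = avoid y p<y (≤∧≢⇒< (s≤s⁻¹ y<x+2) y≢x+1)

  firstVisitAfter : ∀ x e → v (suc x + e) ≡ t →
    ∃ λ q → x < q × v q ≡ t × AvoidsBetween x q
  firstVisitAfter x e vr with v (suc x) F.≟ t
  ... | yes hit = suc x , ≤-refl , hit , λ y x<y y<q → ⊥-elim (<-irrefl refl (<-≤-trans y<q x<y))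
  firstVisitAfter x zero vr | no miss = ⊥-elim (miss (subst (λ z → v z ≡ t) (cong suc (+-identityʳ x)) vr))
  firstVisitAfter x (suc e) vr | no miss
    with firstVisitAfter (suc x) e (subst (λ z → v z ≡ t) (+-suc (suc x) e) vr)
  ... | q , x+1<q , vq , avoid = q , <-trans (n<1+n x) x+1<q , vq , avoid′
    where
    avoid′ : AvoidsBetween x q
    avoid′ y x<y y<q with y ≟ suc x
    ... | yes refl = miss
    ... | no y≢x+1 = avoid y (≤∧≢⇒< x<y (λ x+1≡y → y≢x+1 (sym x+1≡y))) y<q

  enclosingVisits : ∀ {s r} x m → v s ≡ t → s ≤ x → v r ≡ t → x + m < r →
    (∀ l → l ≤ m → v (x + l) ≢ t) →
    ∃ λ p → ∃ λ A → ∃ λ B → p + A ≡ x × ConsecutiveVisits v t p (A + (m + B))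
  enclosingVisits {s} {r} x m vs s≤x vr x+m<r window
    with lastVisitUpTo x vs s≤x
       | firstVisitAfter (x + m) (r ∸ suc (x + m))
           (subst (λ z → v z ≡ t) (sym (m+[n∸m]≡n x+m<r)) vr)
  ... | p , p≤x , vp , avoid₁ | q , x+m<q , vq , avoid₂ =
    p , A , B , pA , ≤-trans 1≤A (m≤m+n A (m + B)) , vp , trans (cong v pq) vq , inner
    where
    A = x ∸ p
    B = q ∸ (x + m)
    pA : p + A ≡ x
    pA = m+[n∸m]≡n p≤x
    pq : p + (A + (m + B)) ≡ q
    pq = begin
      p + (A + (m + B)) ≡⟨ sym (+-assoc p A (m + B)) ⟩
      p + A + (m + B)   ≡⟨ cong (_+ (m + B)) pA ⟩
      x + (m + B)       ≡⟨ sym (+-assoc x m B) ⟩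
      x + m + B         ≡⟨ m+[n∸m]≡n (<⇒≤ x+m<q) ⟩
      q                 ∎
      where open ≡-Reasoning
    x-avoids : v x ≢ t
    x-avoids = subst (λ z → v z ≢ t) (+-identityʳ x) (window 0 z≤n)
    1≤A : 1 ≤ A
    1≤A with A | pA
    ... | zero  | p+0≡x = ⊥-elim (x-avoids (subst (λ z → v z ≡ t) (trans (sym (+-identityʳ p)) p+0≡x) vp))
    ... | suc _ | _     = s≤s z≤n
    avoids : AvoidsBetween p q
    avoids y p<y y<q with y ≤? x
    ... | yes y≤x = avoid₁ y p<y (s≤s y≤x)
    ... | no y≰x with y ≤? x + m
    ...   | yes y≤x+m = subst (λ z → v z ≢ t) (m+[n∸m]≡n x≤y)
                          (window (y ∸ x) (subst (y ∸ x ≤_) (m+n∸m≡n x m) (∸-monoˡ-≤ x y≤x+m)))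
      where
      x≤y : x ≤ y
      x≤y = <⇒≤ (≰⇒> y≰x)
    ...   | no y≰x+m = avoid₂ y (≰⇒> y≰x+m) y<q
    inner : ∀ l → 0 < l → l < A + (m + B) → v (p + l) ≢ t
    inner l 0<l l<len = avoids (p + l) (m<m+n p 0<l) (subst (p + l <_) pq (+-monoʳ-< p l<len))

module Period {n k : ℕ} (W : ClosedWalk n k) where

  seq-periodic : ∀ a x → seq W (x + a * k) ≡ seq W x
  seq-periodic zero x = cong (seq W) (+-identityʳ x)
  seq-periodic (suc a) x = begin
    seq W (x + (k + a * k)) ≡⟨ cong (seq W) (x+[k+y]≡x+y+k) ⟩
    seq W (x + a * k + k)   ≡⟨ periodic W (x + a * k) ⟩
    seq W (x + a * k)       ≡⟨ seq-periodic a x ⟩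
    seq W x                 ∎
    where
    open ≡-Reasoning
    x+[k+y]≡x+y+k : x + (k + a * k) ≡ x + a * k + k
    x+[k+y]≡x+y+k = trans (cong (x +_) (+-comm k (a * k))) (sym (+-assoc x (a * k) k))

  seq-shift : ∀ i l → seq W (i + k + l) ≡ seq W (i + l)
  seq-shift i l = trans (cong (seq W) (+-shift i)) (periodic W (i + l))
    where
    +-shift : ∀ i → i + k + l ≡ i + l + k
    +-shift i = trans (+-assoc i k l) (trans (cong (i +_) (+-comm k l)) (sym (+-assoc i l k)))

  recursAfter : 1 ≤ k → ∀ s x → ∃ λ r → x < r × seq W r ≡ seq W s
  recursAfter 1≤k s x = s + suc x * k , x<r , seq-periodic (suc x) s
    where
    x<r : x < s + suc x * k
    x<r = ≤-trans (subst (_≤ suc x * k) (*-identityʳ (suc x)) (*-monoʳ-≤ (suc x) 1≤k))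
                  (m≤n+m (suc x * k) s)

bindingSubwalk-visits : ∀ {n k} (T : TravelTimes n) → 1 ≤ k → (W : ClosedWalk n k) →
  ∀ R → IsRevisitTime T W R →
  ∀ d i m → ConsecutiveVisits (seq W) d i m → pathCost (TravelTimes.c T) (seq W) i m ≡ R →
  ∀ t → (∀ l → l ≤ m → seq W (i + l) ≢ t) → ⊥
bindingSubwalk-visits {k = k} T 1≤k W R (bounded , _) d i m (_ , vi , _ , _) cost t missed
  with covers W t
... | s , s<k , vs with Period.recursAfter W 1≤k s (i + k + m)
... | r , after , vr
  with Visits.enclosingVisits v t (i + k) m vs s≤i′ (trans vr vs) after missed′
  where
  v = seq W
  s≤i′ : s ≤ i + k
  s≤i′ = ≤-trans (<⇒≤ s<k) (m≤n+m k i)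
  missed′ : ∀ l → l ≤ m → v (i + k + l) ≢ t
  missed′ l l≤m = subst (λ z → z ≢ t) (sym (Period.seq-shift W i l)) (missed l l≤m)
... | p , A , B , pA , visits = QP.<-irrefl refl (QP.<-≤-trans R<cost (bounded t p (A + (m + B)) visits))
  where
  open TravelTimes T
  open TravelCost T
  v = seq W
  vp≡t : v p ≡ t
  vp≡t = let (_ , vp , _) = visits in vp
  vi′≡d : v (p + A) ≡ d
  vi′≡d = trans (cong v pA) (trans (periodic W i) vi)
  t≢d : t ≢ d
  t≢d t≡d = missed 0 z≤n (trans (cong v (+-identityʳ i)) (trans vi (sym t≡d)))
  shifted-cost : pathCost c v (p + A) m ≡ R
  shifted-cost = trans (cong (λ z → pathCost c v z m) pA)
                       (trans (WalkCost.pathCost-periodic c v k (periodic W) i m) cost)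
  R<cost : R Q.< pathCost c v p (A + (m + B))
  R<cost = begin-strict
    R                                              ≡⟨ sym (QP.+-identityˡ R) ⟩
    Q.0ℚ Q.+ R                                     <⟨ QP.+-monoˡ-< R (pos t d t≢d) ⟩
    c t d Q.+ R                                    ≡⟨ sym (cong₂ Q._+_ (cong₂ c vp≡t vi′≡d) shifted-cost) ⟩
    c (v p) (v (p + A)) Q.+ pathCost c v (p + A) m ≤⟨ enclosing-pathCost v p A m B ⟩
    pathCost c v p (A + (m + B))                   ∎
    where open QP.≤-Reasoning

lemma1 : (n : ℕ) → 2 ≤ n → (T : TravelTimes n) → (k : ℕ) → n ≤ k →
    (W : ClosedWalk n k) → (Rstar : ℚ) →
    IsOptimalRevisitTime T k Rstar → IsRevisitTime T W Rstar →
    (d : Fin n) → (i m : ℕ) → ConsecutiveVisits (seq W) d i m →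
    pathCost (TravelTimes.c T) (seq W) i m ≡ Rstar →
    ∀ (t : Fin n) → ∃ λ l → l ≤ m × seq W (i + l) ≡ t
lemma1 n 2≤n T k n≤k W Rstar _ isRT d i m visits cost t
  with anyUpTo? (λ l → seq W (i + l) F.≟ t) (suc m)
... | yes (l , l<m+1 , hit) = l , s≤s⁻¹ l<m+1 , hit
... | no none = ⊥-elim (bindingSubwalk-visits T 1≤k W Rstar isRT d i m visits cost t
                          (λ l l≤m hit → none (l , s≤s l≤m , hit)))
  where
  1≤k : 1 ≤ k
  1≤k = ≤-trans (≤-trans (s≤s z≤n) 2≤n) n≤k
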